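{- Let $p \geq 5$ be a prime number. For every integer $n\ge 0$ let $T_n$ denote the $n$th central trinomial coefficient. Then for every integer $j$ with $0 \leq j \leq p-1$, we have $p \mid T_j$ if and only if $p \mid T_{p-1-j}$.
   Context: For an integer $n \geq 0$, the $n$th central trinomial coefficient $T_n$ is the coefficient of $x^n$ in the expansion of $(1+x+x^2)^n$ (equivalently, the largest coefficient of this polynomial). -}

module Defs where

open import Data.Nat using (ℕ; zero; suc; _+_; _*_)
open import Data.List using (List; []; _∷_; map; replicate)

-- Polynomials over ℕ as coefficient lists, lowest degree first.
Poly : Set
Poly = List ℕ

_⊕_ : Poly → Poly → Poly
[] ⊕ q = q
(a ∷ p) ⊕ [] = a ∷ p
(a ∷ p) ⊕ (b ∷ q) = (a + b) ∷ (p ⊕ q)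

_⊗_ : Poly → Poly → Poly
[] ⊗ q = []
(a ∷ p) ⊗ q = map (a *_) q ⊕ (0 ∷ (p ⊗ q))

_⊗^_ : Poly → ℕ → Poly
p ⊗^ zero = 1 ∷ []
p ⊗^ suc n = p ⊗ (p ⊗^ n)

coeff : Poly → ℕ → ℕ
coeff [] k = 0
coeff (a ∷ p) zero = a
coeff (a ∷ p) (suc k) = coeff p k

trinom : Poly
trinom = 1 ∷ 1 ∷ 1 ∷ []

T : ℕ → ℕ
T n = coeff (trinom ⊗^ n) n

{-# OPTIONS --safe #-}
module Submission where

-- Comparing coefficients in the power rule x (f^(n+1))′ = (n + 1) f^n · x f′ for f = 1 + x + x² gives
-- (n + 2) T (n + 2) = (2n + 3) T (n + 1) + 3 (n + 1) T n.  Read backwards modulo p, this recurrence says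
-- that the reflected sequence (−3)^n T (p − 1 − n) satisfies it too, for n < p.  So does T (p − 1) · T n,
-- with the same first two values, and as the leading coefficient n + 2 is invertible below p,
-- (−3)^n T (p − 1 − n) ≡ T (p − 1) · T n (mod p).  Hence p ∣ T j ⇔ p ∣ T (p − 1 − j) as soon as
-- (−3)^j and T (p − 1) are units mod p, which holds since p ≠ 3.

open import Defs
open import Data.Nat using (ℕ; _≤_; _∸_)
open import Data.Nat.Divisibility using (_∣_)
open import Data.Nat.Primality using (Prime)
open import Function.Bundles using (_⇔_)

open import Data.Nat as ℕ using (zero; suc; _<_; z≤n; s≤s; nonTrivial⇒n>1)
import Data.Nat.Properties as ℕ
open import Data.Nat.Divisibility using (>⇒∤)
open import Data.Nat.Primality using (euclidsLemma; prime⇒nonTrivial)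
open import Data.List using ([]; _∷_; map; replicate)
open import Data.List.Properties using (map-id; map-cong)
open import Data.Product using (_,_)
open import Data.Sum using (inj₁; inj₂)
open import Function.Base using (_∘_)
open import Function.Bundles using (mk⇔)
open import Relation.Binary.Bundles using (Setoid)
open import Relation.Nullary using (¬_; contradiction)
open import Relation.Binary.PropositionalEquality
  using (_≡_; refl; sym; trans; cong; cong₂; subst; module ≡-Reasoning)

module _ where
  open import Data.Nat using (_+_; _*_)
  open import Data.Nat.Properties using (*-identityˡ; *-zeroʳ; +-identityʳ; +-assoc; *-cancelˡ-≡; +-cancelʳ-≡)
  open import Data.Nat.Tactic.RingSolver using (solve)
  open ≡-Reasoning

  coeff-⊕ : ∀ p q k → coeff (p ⊕ q) k ≡ coeff p k + coeff q k
  coeff-⊕ []      q       k       = refl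
  coeff-⊕ (a ∷ p) []      k       = sym (+-identityʳ _)
  coeff-⊕ (a ∷ p) (b ∷ q) zero    = refl
  coeff-⊕ (a ∷ p) (b ∷ q) (suc k) = coeff-⊕ p q k

  coeff-replicate-0 : ∀ n k → coeff (replicate n 0) k ≡ 0
  coeff-replicate-0 zero    k       = refl
  coeff-replicate-0 (suc n) zero    = refl
  coeff-replicate-0 (suc n) (suc k) = coeff-replicate-0 n k

  map-1* : ∀ q → map (1 *_) q ≡ q
  map-1* q = trans (map-cong *-identityˡ q) (map-id q)

  coeff-trinom-⊗ : ∀ q k → coeff (trinom ⊗ q) k ≡ coeff q k + coeff (0 ∷ q) k + coeff (0 ∷ 0 ∷ q) k
  coeff-trinom-⊗ q k = begin
    coeff (trinom ⊗ q) k
      -- trinom ⊗ q unfolds to this nested sum, with map (1 *_) q in place of q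
      ≡⟨ cong (λ r → coeff (r ⊕ ((0 ∷ r) ⊕ ((0 ∷ 0 ∷ r) ⊕ replicate 3 0))) k) (map-1* q) ⟩
    coeff (q ⊕ ((0 ∷ q) ⊕ ((0 ∷ 0 ∷ q) ⊕ replicate 3 0))) k
      ≡⟨ coeff-⊕ q ((0 ∷ q) ⊕ ((0 ∷ 0 ∷ q) ⊕ replicate 3 0)) k ⟩
    a + coeff ((0 ∷ q) ⊕ ((0 ∷ 0 ∷ q) ⊕ replicate 3 0)) k
      ≡⟨ cong (a +_) (coeff-⊕ (0 ∷ q) ((0 ∷ 0 ∷ q) ⊕ replicate 3 0) k) ⟩
    a + (b + coeff ((0 ∷ 0 ∷ q) ⊕ replicate 3 0) k)
      ≡⟨ cong (λ z → a + (b + z)) (coeff-⊕ (0 ∷ 0 ∷ q) (replicate 3 0) k) ⟩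
    a + (b + (c + coeff (replicate 3 0) k))
      ≡⟨ cong (λ z → a + (b + (c + z))) (coeff-replicate-0 3 k) ⟩
    a + (b + (c + 0))
      ≡⟨ cong (λ z → a + (b + z)) (+-identityʳ c) ⟩
    a + (b + c)
      ≡⟨ +-assoc a b c ⟨
    a + b + c ∎
    where
    a = coeff q k
    b = coeff (0 ∷ q) k
    c = coeff (0 ∷ 0 ∷ q) k

  -- The coefficient of x^k in x (f^(n+1))′ = (n + 1) f^n · x f′, for f = 1 + x + x² and f′ = 1 + 2x.
  coeff-power-rule : ∀ n k →
    k * coeff (trinom ⊗^ suc n) k ≡ suc n * (coeff (0 ∷ trinom ⊗^ n) k + 2 * coeff (0 ∷ 0 ∷ trinom ⊗^ n) k)
  coeff-power-rule n       zero                = sym (*-zeroʳ (suc n))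
  coeff-power-rule zero    (suc zero)          = refl
  coeff-power-rule zero    (suc (suc zero))    = refl
  coeff-power-rule zero    (suc (suc (suc k))) = *-zeroʳ (3 + k)
  coeff-power-rule (suc n) (suc zero)          =
    step (coeff A 1) (coeff B 0) (coeff-trinom-⊗ A 1) (coeff-trinom-⊗ B 0) (coeff-power-rule n 1)
    where
    A = trinom ⊗^ suc n
    B = trinom ⊗^ n
    step : ∀ {c a₀} a₁ b₀ →
           c ≡ a₁ + a₀ + 0 → a₀ ≡ b₀ + 0 + 0 → 1 * a₁ ≡ suc n * (b₀ + 2 * 0) →
           1 * c ≡ suc (suc n) * (a₀ + 2 * 0)
    step a₁ b₀ refl refl ih = begin
      1 * (a₁ + (b₀ + 0 + 0) + 0)         ≡⟨ solve (a₁ ∷ b₀ ∷ []) ⟩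
      1 * a₁ + b₀                         ≡⟨ cong (_+ b₀) ih ⟩
      suc n * (b₀ + 2 * 0) + b₀           ≡⟨ solve (n ∷ b₀ ∷ []) ⟩
      suc (suc n) * (b₀ + 0 + 0 + 2 * 0)  ∎
  coeff-power-rule (suc n) (suc (suc k))       =
    step (coeff A (2 + k)) (coeff B (1 + k)) (coeff B k) (coeff (0 ∷ B) k) (coeff (0 ∷ 0 ∷ B) k)
         (coeff-trinom-⊗ A (2 + k)) (coeff-trinom-⊗ B (1 + k)) (coeff-trinom-⊗ B k)
         (coeff-power-rule n (2 + k)) (coeff-power-rule n (1 + k)) (coeff-power-rule n k)
    where
    A = trinom ⊗^ suc n
    B = trinom ⊗^ n
    step : ∀ {c a₁ a₀} a₂ b₁ b₀ b₋₁ b₋₂ →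
           c ≡ a₂ + a₁ + a₀ → a₁ ≡ b₁ + b₀ + b₋₁ → a₀ ≡ b₀ + b₋₁ + b₋₂ →
           (2 + k) * a₂ ≡ suc n * (b₁ + 2 * b₀) →
           (1 + k) * a₁ ≡ suc n * (b₀ + 2 * b₋₁) →
           k * a₀ ≡ suc n * (b₋₁ + 2 * b₋₂) →
           (2 + k) * c ≡ suc (suc n) * (a₁ + 2 * a₀)
    step a₂ b₁ b₀ b₋₁ b₋₂ refl refl refl ih₂ ih₁ ih₀ = begin
      (2 + k) * (a₂ + (b₁ + b₀ + b₋₁) + (b₀ + b₋₁ + b₋₂))
        ≡⟨ solve (k ∷ a₂ ∷ b₁ ∷ b₀ ∷ b₋₁ ∷ b₋₂ ∷ []) ⟩
      (2 + k) * a₂ + (1 + k) * (b₁ + b₀ + b₋₁) + k * (b₀ + b₋₁ + b₋₂)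
        + (b₁ + b₀ + b₋₁ + 2 * (b₀ + b₋₁ + b₋₂))
        ≡⟨ cong₂ _+_ (cong₂ _+_ (cong₂ _+_ ih₂ ih₁) ih₀) refl ⟩
      suc n * (b₁ + 2 * b₀) + suc n * (b₀ + 2 * b₋₁) + suc n * (b₋₁ + 2 * b₋₂)
        + (b₁ + b₀ + b₋₁ + 2 * (b₀ + b₋₁ + b₋₂))
        ≡⟨ solve (n ∷ b₁ ∷ b₀ ∷ b₋₁ ∷ b₋₂ ∷ []) ⟩
      suc (suc n) * ((b₁ + b₀ + b₋₁) + 2 * (b₀ + b₋₁ + b₋₂)) ∎

  T₋₁ T₋₂ : ℕ → ℕ
  T₋₁ n = coeff (0 ∷ trinom ⊗^ n) n
  T₋₂ n = coeff (0 ∷ 0 ∷ trinom ⊗^ n) n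

  T-suc : ∀ n → T (suc n) ≡ T n + 2 * T₋₁ n
  T-suc n = *-cancelˡ-≡ _ _ (suc n) (coeff-power-rule n (suc n))

  T₋₁-suc : ∀ n → T₋₁ (suc n) ≡ T n + T₋₁ n + T₋₂ n
  T₋₁-suc n = coeff-trinom-⊗ (trinom ⊗^ n) n

  n*T≡T₋₁+[2+n]*T₋₂ : ∀ n → n * T n ≡ T₋₁ n + (2 + n) * T₋₂ n
  n*T≡T₋₁+[2+n]*T₋₂ n =
    rearrange (T n) (T₋₁ n) (T₋₂ n) (trans (cong (n *_) (sym (T₋₁-suc n))) (coeff-power-rule n n))
    where
    rearrange : ∀ t u v → n * (t + u + v) ≡ suc n * (u + 2 * v) → n * t ≡ u + (2 + n) * v
    rearrange t u v eq = +-cancelʳ-≡ (n * u + n * v) (n * t) (u + (2 + n) * v) (begin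
      n * t + (n * u + n * v)        ≡⟨ solve (n ∷ t ∷ u ∷ v ∷ []) ⟩
      n * (t + u + v)                ≡⟨ eq ⟩
      suc n * (u + 2 * v)            ≡⟨ solve (n ∷ u ∷ v ∷ []) ⟩
      u + (2 + n) * v + (n * u + n * v) ∎)

  T-recurrence : ∀ n → (2 + n) * T (2 + n) ≡ (3 + 2 * n) * T (1 + n) + 3 * (1 + n) * T n
  T-recurrence n =
    combine (T-suc n)
            (trans (T-suc (1 + n)) (cong (λ u → T (1 + n) + 2 * u) (T₋₁-suc n)))
            (n*T≡T₋₁+[2+n]*T₋₂ n)
    where
    combine : ∀ {t₁ t₂} {t₀ u v} →
              t₁ ≡ t₀ + 2 * u → t₂ ≡ t₁ + 2 * (t₀ + u + v) → n * t₀ ≡ u + (2 + n) * v →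
              (2 + n) * t₂ ≡ (3 + 2 * n) * t₁ + 3 * (1 + n) * t₀
    combine {t₀ = t₀} {u} {v} refl refl eq = begin
      (2 + n) * (t₀ + 2 * u + 2 * (t₀ + u + v))
        ≡⟨ solve (n ∷ t₀ ∷ u ∷ v ∷ []) ⟩
      3 * (2 + n) * t₀ + 2 * (3 + 2 * n) * u + 2 * (u + (2 + n) * v)
        ≡⟨ cong (λ x → 3 * (2 + n) * t₀ + 2 * (3 + 2 * n) * u + 2 * x) eq ⟨
      3 * (2 + n) * t₀ + 2 * (3 + 2 * n) * u + 2 * (n * t₀)
        ≡⟨ solve (n ∷ t₀ ∷ u ∷ []) ⟩
      (3 + 2 * n) * (t₀ + 2 * u) + 3 * (1 + n) * t₀ ∎

open import Data.Integer using (ℤ; +_; _+_; _*_; -_; _-_; _^_; ∣_∣; 0ℤ; 1ℤ)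
open import Data.Integer.Properties using (pos-*; pos-+; abs-*; +-inverseʳ; *-identityˡ; *-identityʳ)
open import Data.Integer.Divisibility.Signed
  using (divides; ∣ᵤ⇒∣; ∣⇒∣ᵤ; ∣m∣n⇒∣m+n; ∣m⇒∣-m; ∣n⇒∣m*n)
  renaming (_∣_ to _∣ℤ_)
open import Data.Integer.Tactic.RingSolver using (solve)

T-recurrenceℤ : ∀ n →
  (+ 2 + + n) * + T (2 ℕ.+ n) ≡ (+ 3 + + 2 * + n) * + T (1 ℕ.+ n) + + 3 * (+ 1 + + n) * + T n
T-recurrenceℤ n = begin
  (+ 2 + + n) * + T₂
    ≡⟨ pos-* (2 ℕ.+ n) T₂ ⟨
  + ((2 ℕ.+ n) ℕ.* T₂)
    ≡⟨ cong +_ (T-recurrence n) ⟩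
  + ((3 ℕ.+ 2 ℕ.* n) ℕ.* T₁ ℕ.+ 3 ℕ.* (1 ℕ.+ n) ℕ.* T₀)
    ≡⟨ pos-+ ((3 ℕ.+ 2 ℕ.* n) ℕ.* T₁) (3 ℕ.* (1 ℕ.+ n) ℕ.* T₀) ⟩
  + ((3 ℕ.+ 2 ℕ.* n) ℕ.* T₁) + + (3 ℕ.* (1 ℕ.+ n) ℕ.* T₀)
    ≡⟨ cong₂ _+_ (pos-* (3 ℕ.+ 2 ℕ.* n) T₁) (pos-* (3 ℕ.* (1 ℕ.+ n)) T₀) ⟩
  (+ 3 + + (2 ℕ.* n)) * + T₁ + + (3 ℕ.* (1 ℕ.+ n)) * + T₀
    ≡⟨ cong₂ (λ x y → (+ 3 + x) * + T₁ + y * + T₀) (pos-* 2 n) (pos-* 3 (1 ℕ.+ n)) ⟩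
  (+ 3 + + 2 * + n) * + T₁ + + 3 * (+ 1 + + n) * + T₀ ∎
  where
  open ≡-Reasoning
  T₀ = T n
  T₁ = T (1 ℕ.+ n)
  T₂ = T (2 ℕ.+ n)

-- A record rather than a function into m ∣ x - y, so that x and y can be inferred from the type.
infix 4 _≡_mod_
record _≡_mod_ (x y m : ℤ) : Set where
  constructor mod-by
  field divides-difference : m ∣ℤ x - y

module _ {m : ℤ} where

  mod-refl : ∀ {x} → x ≡ x mod m
  mod-refl {x} = mod-by (divides 0ℤ (+-inverseʳ x))

  mod-reflexive : ∀ {x y} → x ≡ y → x ≡ y mod m
  mod-reflexive refl = mod-refl

  mod-sym : ∀ {x y} → x ≡ y mod m → y ≡ x mod m
  mod-sym {x} {y} (mod-by m∣x-y) = mod-by (subst (m ∣ℤ_) eq (∣m⇒∣-m m∣x-y))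
    where eq : - (x - y) ≡ y - x
          eq = solve (x ∷ y ∷ [])

  mod-trans : ∀ {x y z} → x ≡ y mod m → y ≡ z mod m → x ≡ z mod m
  mod-trans {x} {y} {z} (mod-by m∣x-y) (mod-by m∣y-z) =
    mod-by (subst (m ∣ℤ_) eq (∣m∣n⇒∣m+n m∣x-y m∣y-z))
    where eq : (x - y) + (y - z) ≡ x - z
          eq = solve (x ∷ y ∷ z ∷ [])

  mod-+-cong : ∀ {x y u v} → x ≡ y mod m → u ≡ v mod m → x + u ≡ y + v mod m
  mod-+-cong {x} {y} {u} {v} (mod-by m∣x-y) (mod-by m∣u-v) =
    mod-by (subst (m ∣ℤ_) eq (∣m∣n⇒∣m+n m∣x-y m∣u-v))
    where eq : (x - y) + (u - v) ≡ (x + u) - (y + v)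
          eq = solve (x ∷ y ∷ u ∷ v ∷ [])

  mod-*-congˡ : ∀ a {x y} → x ≡ y mod m → a * x ≡ a * y mod m
  mod-*-congˡ a {x} {y} (mod-by m∣x-y) = mod-by (subst (m ∣ℤ_) eq (∣n⇒∣m*n a m∣x-y))
    where eq : a * (x - y) ≡ a * x - a * y
          eq = solve (a ∷ x ∷ y ∷ [])

  ∣-resp-mod : ∀ {x y} → x ≡ y mod m → m ∣ℤ y → m ∣ℤ x
  ∣-resp-mod {x} {y} (mod-by m∣x-y) m∣y = subst (m ∣ℤ_) eq (∣m∣n⇒∣m+n m∣x-y m∣y)
    where eq : (x - y) + y ≡ x
          eq = solve (x ∷ y ∷ [])

mod-setoid : ℤ → Setoid _ _
mod-setoid m = record
  { Carrier       = ℤ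
  ; _≈_           = _≡_mod m
  ; isEquivalence = record { refl = mod-refl ; sym = mod-sym ; trans = mod-trans }
  }

module _ {p : ℕ} (p-prime : Prime p) where

  ∤a∣a*b⇒∣b : ∀ {a b} → ¬ + p ∣ℤ a → + p ∣ℤ a * b → + p ∣ℤ b
  ∤a∣a*b⇒∣b {a} {b} p∤a p∣ab
    with euclidsLemma ∣ a ∣ ∣ b ∣ p-prime (subst (p ∣_) (abs-* a b) (∣⇒∣ᵤ p∣ab))
  ... | inj₁ p∣a = contradiction (∣ᵤ⇒∣ p∣a) p∤a
  ... | inj₂ p∣b = ∣ᵤ⇒∣ p∣b

  *-cancelˡ-mod : ∀ a {x y} → ¬ + p ∣ℤ a → a * x ≡ a * y mod + p → x ≡ y mod + p
  *-cancelˡ-mod a {x} {y} p∤a (mod-by p∣ax-ay) = mod-by (∤a∣a*b⇒∣b p∤a (subst (+ p ∣ℤ_) eq p∣ax-ay))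
    where eq : a * x - a * y ≡ a * (x - y)
          eq = solve (a ∷ x ∷ y ∷ [])

  ∤-^ : ∀ {a} → ¬ + p ∣ℤ a → ∀ n → ¬ + p ∣ℤ a ^ n
  ∤-^ p∤a zero    = >⇒∤ (nonTrivial⇒n>1 p {{prime⇒nonTrivial p-prime}}) ∘ ∣⇒∣ᵤ
  ∤-^ p∤a (suc n) = ∤-^ p∤a n ∘ ∤a∣a*b⇒∣b p∤a

  associates-∣⇔ : ∀ {a b} x y → ¬ + p ∣ℤ a → ¬ + p ∣ℤ b →
                  a * + x ≡ b * + y mod + p → (p ∣ x) ⇔ (p ∣ y)
  associates-∣⇔ {a} {b} x y p∤a p∤b ax≡by = mk⇔
    (λ p∣x → ∣⇒∣ᵤ (∤a∣a*b⇒∣b p∤b (∣-resp-mod (mod-sym ax≡by) (∣n⇒∣m*n a (∣ᵤ⇒∣ p∣x)))))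
    (λ p∣y → ∣⇒∣ᵤ (∤a∣a*b⇒∣b p∤a (∣-resp-mod ax≡by (∣n⇒∣m*n b (∣ᵤ⇒∣ p∣y)))))

Recurrent : ℕ → (ℕ → ℤ) → Set
Recurrent p u = ∀ n → 2 ℕ.+ n < p →
  (+ 2 + + n) * u (2 ℕ.+ n) ≡ (+ 3 + + 2 * + n) * u (1 ℕ.+ n) + + 3 * (+ 1 + + n) * u n mod + p

recurrent-unique : ∀ {p u v} → Prime p → Recurrent p u → Recurrent p v →
  u 0 ≡ v 0 mod + p → u 1 ≡ v 1 mod + p → ∀ n → n < p → u n ≡ v n mod + p
recurrent-unique {p} {u} {v} p-prime u-rec v-rec u₀≡v₀ u₁≡v₁ = agree
  where
  open import Relation.Binary.Reasoning.Setoid (mod-setoid (+ p))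
  agree : ∀ n → n < p → u n ≡ v n mod + p
  agree 0             _  = u₀≡v₀
  agree 1             _  = u₁≡v₁
  agree (suc (suc n)) lt = *-cancelˡ-mod p-prime (+ 2 + + n) (>⇒∤ lt ∘ ∣⇒∣ᵤ) (begin
    (+ 2 + + n) * u (2 ℕ.+ n)
      ≈⟨ u-rec n lt ⟩
    (+ 3 + + 2 * + n) * u (1 ℕ.+ n) + + 3 * (+ 1 + + n) * u n
      ≈⟨ mod-+-cong (mod-*-congˡ (+ 3 + + 2 * + n) (agree (suc n) (ℕ.<⇒≤ lt)))
                    (mod-*-congˡ (+ 3 * (+ 1 + + n)) (agree n (ℕ.<⇒≤ (ℕ.<⇒≤ lt)))) ⟩
    (+ 3 + + 2 * + n) * v (1 ℕ.+ n) + + 3 * (+ 1 + + n) * v n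
      ≈⟨ v-rec n lt ⟨
    (+ 2 + + n) * v (2 ℕ.+ n) ∎)

mod-by-relation : ∀ {x y m l r} q k → l ≡ r → x - y ≡ q * m + k * (l - r) → x ≡ y mod m
mod-by-relation {m = m} {l} q k refl eq = mod-by (divides q (trans eq (lemma (q * m) k l)))
  where
  lemma : ∀ a k l → a + k * (l - l) ≡ a
  lemma a k l = solve (a ∷ k ∷ l ∷ [])

-- Modulo N + M + 3 the coefficients 2 + M, 3 + 2M, 3 (1 + M) of the recurrence at M are
-- −(1 + N), −(3 + 2N), −3 (2 + N).
mirror-recurrence : ∀ N M x a b c →
  (+ 2 + M) * a ≡ (+ 3 + + 2 * M) * b + + 3 * (+ 1 + M) * c →
  (+ 2 + N) * (- + 3 * (- + 3 * x) * c) ≡ (+ 3 + + 2 * N) * (- + 3 * x * b) + + 3 * (+ 1 + N) * (x * a)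
    mod (+ 3 + (N + M))
mirror-recurrence N M x a b c rec = mod-by-relation (+ 3 * x * (+ 3 * c + + 2 * b - a)) (+ 3 * x) rec
  (solve (N ∷ M ∷ x ∷ a ∷ b ∷ c ∷ []))

-- Modulo 2 + M the recurrence at M reads 0 ≡ −b − 3c.
mirror-initial : ∀ M a b c →
  (+ 2 + M) * a ≡ (+ 3 + + 2 * M) * b + + 3 * (+ 1 + M) * c → - + 3 * c ≡ b mod (+ 2 + M)
mirror-initial M a b c rec = mod-by-relation (a - + 2 * b - + 3 * c) (- 1ℤ) rec (solve (M ∷ a ∷ b ∷ c ∷ []))

reflected-recurrent : ∀ m → Recurrent (2 ℕ.+ m) (λ n → (- + 3) ^ n * + T (suc m ∸ n))
reflected-recurrent m n (s≤s (s≤s 1+n≤m)) with ℕ.m≤n⇒∃[o]m+o≡n 1+n≤m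
... | k , refl rewrite ℕ.+-∸-assoc 2 (ℕ.m≤m+n n k) | ℕ.+-∸-assoc 1 (ℕ.m≤m+n n k) | ℕ.m+n∸m≡n n k =
  mirror-recurrence (+ n) (+ k) ((- + 3) ^ n) (+ T (2 ℕ.+ k)) (+ T (1 ℕ.+ k)) (+ T k) (T-recurrenceℤ k)

scaled-recurrent : ∀ p c → Recurrent p (λ n → c * + T n)
scaled-recurrent p c n _ = mod-reflexive (scale (+ n) (T-recurrenceℤ n))
  where
  scale : ∀ N {a b d} → (+ 2 + N) * a ≡ (+ 3 + + 2 * N) * b + + 3 * (+ 1 + N) * d →
          (+ 2 + N) * (c * a) ≡ (+ 3 + + 2 * N) * (c * b) + + 3 * (+ 1 + N) * (c * d)
  scale N {a} {b} {d} eq = begin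
    (+ 2 + N) * (c * a)                                  ≡⟨ solve (N ∷ c ∷ a ∷ []) ⟩
    c * ((+ 2 + N) * a)                                  ≡⟨ cong (c *_) eq ⟩
    c * ((+ 3 + + 2 * N) * b + + 3 * (+ 1 + N) * d)      ≡⟨ solve (N ∷ c ∷ b ∷ d ∷ []) ⟩
    (+ 3 + + 2 * N) * (c * b) + + 3 * (+ 1 + N) * (c * d) ∎
    where open ≡-Reasoning

reflection : ∀ {m} → Prime (2 ℕ.+ m) → ∀ {n} → n ≤ suc m →
  (- + 3) ^ n * + T (suc m ∸ n) ≡ + T (suc m) * + T n mod + (2 ℕ.+ m)
reflection {m} p-prime {n} n≤1+m =
  recurrent-unique p-prime (reflected-recurrent m) (scaled-recurrent _ (+ T (suc m)))
                   initial₀ initial₁ n (s≤s n≤1+m)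
  where
  initial₀ : 1ℤ * + T (suc m) ≡ + T (suc m) * 1ℤ mod + (2 ℕ.+ m)
  initial₀ = mod-reflexive (trans (*-identityˡ _) (sym (*-identityʳ _)))
  initial₁ : - + 3 * + T m ≡ + T (suc m) * 1ℤ mod + (2 ℕ.+ m)
  initial₁ = mod-trans (mirror-initial (+ m) (+ T (2 ℕ.+ m)) (+ T (1 ℕ.+ m)) (+ T m) (T-recurrenceℤ m))
                       (mod-reflexive (sym (*-identityʳ _)))

-- The reflection at n = p − 1 reads (−3)^(p − 1) ≡ T (p − 1)² (mod p).
∤-T[p-1] : ∀ {m} → Prime (2 ℕ.+ m) → 3 < 2 ℕ.+ m → ¬ + (2 ℕ.+ m) ∣ℤ + T (suc m)
∤-T[p-1] {m} p-prime 3<p p∣T =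
  >⇒∤ (s≤s (s≤s z≤n)) (∣⇒∣ᵤ (subst (λ i → + (2 ℕ.+ m) ∣ℤ + T i) (ℕ.n∸n≡0 m) p∣T₀))
  where
  p∣T₀ : + (2 ℕ.+ m) ∣ℤ + T (m ∸ m)
  p∣T₀ = ∤a∣a*b⇒∣b p-prime {(- + 3) ^ suc m} (∤-^ p-prime (>⇒∤ 3<p ∘ ∣⇒∣ᵤ) (suc m))
           (∣-resp-mod (reflection p-prime ℕ.≤-refl) (∣n⇒∣m*n (+ T (suc m)) p∣T))

mainTheorem1 : (p : ℕ) → Prime p → 5 ≤ p →
    (j : ℕ) → j ≤ p ∸ 1 →
    (p ∣ T j) ⇔ (p ∣ T (p ∸ 1 ∸ j))
mainTheorem1 (suc (suc m)) p-prime 5≤p j j≤p-1 =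
  associates-∣⇔ p-prime (T j) (T (suc m ∸ j))
    (∤-T[p-1] p-prime 3<p) (∤-^ p-prime (>⇒∤ 3<p ∘ ∣⇒∣ᵤ) j) (mod-sym (reflection p-prime j≤p-1))
  where
  3<p : 3 < 2 ℕ.+ m
  3<p = ℕ.<⇒≤ 5≤p
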